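{- Let $n$ be a square-free even positive integer with $n^2+1 = q$ for a prime $q$, and let $E_n: y^2 = x(x-1)(x+n^2)$. Let $(b_1,b_2)$ be a pair of square-free integers with $b_1>0$, $b_2>0$, $q\nmid b_2$, all of whose prime factors lie in $\{2,q\}\cup\{\text{primes dividing } n\}$, and suppose $(b_1,b_2)\in S^{(2)}(E_n/\mathbb{Q})$. Then $b_2=1$, and for every prime $p$, if $p\mid b_1$ then $p\equiv 1$ or $5 \pmod 8$ and $p\neq q$.
   Context: Via the $2$-descent map $(x,y)\mapsto (x \bmod \mathbb{Q}^{*2},\ (x-1) \bmod \mathbb{Q}^{*2})$, elements of the $2$-Selmer group $S^{(2)}(E_n/\mathbb{Q})$ are identified with pairs $(b_1,b_2)$ of square-free integers (prime factors among $2$, $q$ and the primes dividing $n$) such that the curve $C_{b_1,b_2}$ defined by $b_1z_1^2 - b_2z_2^2 = 1$, $b_1z_1^2 - b_1b_2z_3^2 = -n^2$ has a point over $\mathbb{R}$ and over $\mathbb{Q}_l$ for every prime $l$. The hypotheses $b_1,b_2>0$ and $q\nmid b_2$ are the paper's standing normalization of representatives modulo the image of torsion. -}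

module Defs where

open import Data.Nat as ℕ using (ℕ; suc; _^_)
open import Data.Nat.Divisibility using () renaming (_∣_ to _∣ₙ_)
open import Data.Nat.Primality using (Prime)
open import Data.Integer as ℤ using (ℤ; +_)
open import Data.Integer.Divisibility using (_∣_)
open import Data.Product using (Σ; ∃; _×_)
open import Relation.Nullary using (¬_)

SquareFree : ℕ → Set
SquareFree m = ∀ p → Prime p → ¬ ((p ℕ.* p) ∣ₙ m)

-- The l-adic integers ℤ_l as the inverse limit lim ℤ/l^k ℤ:
-- a sequence of integers x k with x (k+1) ≡ x k (mod l^k).
-- The k-th component represents the class of the l-adic integer mod l^k.
record ℤ_ (l : ℕ) : Set where
  constructor mkℤₗ
  field
    seq : ℕ → ℤ
    coh : ∀ k → (+ (l ^ k)) ∣ (seq (suc k) ℤ.- seq k)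
open ℤ_ public

NonZeroₗ : ∀ {l} → ℤ_ l → Set
NonZeroₗ {l} x = ∃ λ k → ¬ ((+ (l ^ k)) ∣ seq x k)

-- C_{b1,b2} : b1 z1^2 - b2 z2^2 = 1 ,  b1 z1^2 - b1 b2 z3^2 = -n^2 .
-- A ℚ_l-point (z1,z2,z3) is written z_i = w_i / w0 with w_i ∈ ℤ_l, w0 ≠ 0;
-- clearing denominators gives the homogeneous equations
--   b1 w1^2 - b2 w2^2 - w0^2 = 0 ,  b1 w1^2 - b1 b2 w3^2 + n^2 w0^2 = 0 ,
-- which hold in ℤ_l iff they hold mod l^k for every k.
HasQₗPoint : (l b₁ b₂ n : ℕ) → Set
HasQₗPoint l b₁ b₂ n =
  Σ (ℤ_ l) λ w₀ → Σ (ℤ_ l) λ w₁ → Σ (ℤ_ l) λ w₂ → Σ (ℤ_ l) λ w₃ →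
    NonZeroₗ w₀ ×
    (∀ k → let a₀ = seq w₀ k ; a₁ = seq w₁ k ; a₂ = seq w₂ k ; a₃ = seq w₃ k
               B₁ = + b₁ ; B₂ = + b₂ ; N = + n in
       ((+ (l ^ k)) ∣ (B₁ ℤ.* a₁ ℤ.* a₁ ℤ.- B₂ ℤ.* a₂ ℤ.* a₂ ℤ.- a₀ ℤ.* a₀))
     × ((+ (l ^ k)) ∣ (B₁ ℤ.* a₁ ℤ.* a₁ ℤ.- B₁ ℤ.* B₂ ℤ.* a₃ ℤ.* a₃
                        ℤ.+ N ℤ.* N ℤ.* a₀ ℤ.* a₀)))

FactorsIn : (b q n : ℕ) → Set
FactorsIn b q n = ∀ p → Prime p → p ∣ₙ b → (p ≡ 2 ⊎ p ≡ q ⊎ p ∣ₙ n)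
  where
  open import Relation.Binary.PropositionalEquality using (_≡_)
  open import Data.Sum using (_⊎_)

-- Membership of (b1,b2) in the 2-Selmer group, local conditions at the
-- finite primes (the real condition is automatic for b1, b2 > 0)
InSelmerFinite : (b₁ b₂ n : ℕ) → Set
InSelmerFinite b₁ b₂ n = ∀ l → Prime l → HasQₗPoint l b₁ b₂ n

-- Both forms of C_{b₁,b₂} are homogeneous
-- quadratics, so if every solution modulo ℓ³ has all coordinates divisible by ℓ, any ℓ-adic
-- solution can be divided by ℓ indefinitely: w₀ ≡ 0 modulo every power of ℓ, and there is no
-- ℚ_ℓ-point.  This criterion is checked by reducing the forms modulo ℓ, ℓ², ℓ³, peeling off
-- one coordinate at a time:
--   ℓ ∣ b₂ (then ℓ ∣ n, so ℓ ∤ 1 + n² = q), which forces b₂ = 1;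
--   b₂ = 1 and ℓ = 2 ∣ b₁, using that odd squares are 1 mod 8;
--   b₂ = 1 and ℓ = q ∣ b₁, using q ∤ n;
--   b₂ = 1 and ℓ ∣ gcd(b₁, n) with ℓ ≡ 3 mod 4, where −1 is not a square mod ℓ
--   (by Fermat's little theorem), so a₀² + a₂² ≡ 0 forces ℓ ∣ a₀.
-- The hypothesis on the prime factors of b₁ then leaves only odd ℓ ∣ n with ℓ ≡ 1 mod 4.

module Submission where

open import Defs

module Fermat where

  open import Data.Nat as ℕ using (ℕ; zero; suc; _+_; _*_; _∸_; _^_; _<_; _!; s≤s; z≤n)
  import Data.Nat.Properties as ℕ
  import Data.Nat.Tactic.RingSolver as ℕ-Solver
  open import Data.Nat.Properties using (_!*_!≢0)
  open import Data.Nat.Divisibility as ℕ using (_∣_)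
  open import Data.Nat.DivMod using (m/n*n≡m)
  open import Data.Nat.Primality using (Prime; prime⇒nonZero; euclidsLemma; ¬prime[1]; ¬prime[0])
  open import Data.Nat.Combinatorics using (_C_; nCn≡1; nCk≡n!/k![n-k]!; k![n∸k]!∣n!)
  open import Data.Fin as Fin using (Fin; toℕ; inject₁; fromℕ)
  import Data.Fin.Properties as Fin
  open import Data.Vec.Functional using (init)
  open import Data.Product using (∃-syntax; _,_)
  open import Data.Sum using (inj₁; inj₂)
  open import Function using (_∘_)
  open import Relation.Nullary using (¬_; contradiction)
  open import Relation.Binary.PropositionalEquality

  import Algebra.Properties.CommutativeSemiring.Binomial ℕ.+-*-commutativeSemiring as Binomial
  open import Algebra.Properties.Semiring.Sum ℕ.+-*-semiring using (sum; sum-init-last)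
  open import Algebra.Properties.Semiring.Mult ℕ.+-*-semiring renaming (_×_ to _×ₛ_) using ()
  open import Algebra.Properties.Semiring.Exp ℕ.+-*-semiring renaming (_^_ to _^ₛ_) using ()

  ×≡* : ∀ m n → m ×ₛ n ≡ m * n
  ×≡* zero    n = refl
  ×≡* (suc m) n = cong (n +_) (×≡* m n)

  ^ₛ≡^ : ∀ m n → m ^ₛ n ≡ m ^ n
  ^ₛ≡^ m zero    = refl
  ^ₛ≡^ m (suc n) = cong (m *_) (^ₛ≡^ m n)

  ∣-sum : ∀ {d n} (t : Fin n → ℕ) → (∀ i → d ∣ t i) → d ∣ sum t
  ∣-sum {d} {zero} t d∣t = d ℕ.∣0
  ∣-sum {d} {suc n} t d∣t = ℕ.∣m∣n⇒∣m+n (d∣t Fin.zero) (∣-sum (t ∘ Fin.suc) (d∣t ∘ Fin.suc))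

  module _ {p} (p-prime : Prime p) where

    prime∤1 : ¬ p ∣ 1
    prime∤1 p∣1 = ¬prime[1] (subst Prime (ℕ.∣1⇒≡1 p∣1) p-prime)

    prime∤! : ∀ {m} → m < p → ¬ p ∣ m !
    prime∤! {zero}  _   = prime∤1
    prime∤! {suc m} m<p p∣m! with euclidsLemma (suc m) (m !) p-prime p∣m!
    ... | inj₁ p∣m = ℕ.<⇒≱ m<p (ℕ.∣⇒≤ p∣m)
    ... | inj₂ p∣m = prime∤! (ℕ.<-trans (ℕ.n<1+n m) m<p) p∣m

    prime∣C : ∀ {k} → 0 < k → k < p → p ∣ p C k
    prime∣C {k} 0<k k<p with euclidsLemma (p C k) (k ! * (p ∸ k) !) p-prime p∣p!
      where
      instance
        _ = prime⇒nonZero p-prime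
        _ = k !* (p ∸ k) !≢0
      p∣p! : p ∣ (p C k) * (k ! * (p ∸ k) !)
      p∣p! = subst (p ∣_) (sym (trans (cong (_* (k ! * (p ∸ k) !)) (nCk≡n!/k![n-k]! (ℕ.<⇒≤ k<p)))
                                            (m/n*n≡m (k![n∸k]!∣n! (ℕ.<⇒≤ k<p)))))
                           (subst (λ n → n ∣ n !) (ℕ.suc-pred p) (ℕ.m∣m*n (ℕ.pred p !)))
    ... | inj₁ p∣C = p∣C
    ... | inj₂ p∣k![p-k]! with euclidsLemma (k !) ((p ∸ k) !) p-prime p∣k![p-k]!
    ...   | inj₁ p∣k! = contradiction p∣k! (prime∤! k<p)
    ...   | inj₂ p∣[p-k]! = contradiction p∣[p-k]! (prime∤! (ℕ.∸-monoʳ-< {o = 0} 0<k (ℕ.<⇒≤ k<p)))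

  freshmans-dream : ∀ {p} → Prime p → ∀ a → ∃[ t ] (a + 1) ^ p ≡ 1 + (t * p + a ^ p)
  freshmans-dream {zero} p-prime a = contradiction p-prime ¬prime[0]
  freshmans-dream {suc m} p-prime a = t , (begin
    (a + 1) ^ p                               ≡⟨ ^ₛ≡^ (a + 1) p ⟨
    (a + 1) ^ₛ p                              ≡⟨ Binomial.theorem p a 1 ⟩
    term Fin.zero + sum (term ∘ Fin.suc)      ≡⟨ cong (term Fin.zero +_) (sum-init-last (term ∘ Fin.suc)) ⟩
    term Fin.zero + (sum middle + term top)   ≡⟨ cong₂ (λ x y → x + (y + term top)) term-zero sum≡t*p ⟩
    1 + (t * p + term top)                    ≡⟨ cong (λ x → 1 + (t * p + x)) term-top ⟩
    1 + (t * p + a ^ p)                       ∎)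
    where
    open ≡-Reasoning
    p = suc m
    term : Fin (suc p) → ℕ
    term = Binomial.binomialTerm a 1 p
    top : Fin (suc p)
    top = Fin.suc (fromℕ m)
    middle : Fin m → ℕ
    middle = init (term ∘ Fin.suc)
    p∣middle : ∀ i → p ∣ middle i
    p∣middle i = subst (p ∣_) (sym (×≡* (p C suc (toℕ (inject₁ i))) _))
      (ℕ.∣m⇒∣m*n _ (prime∣C p-prime (s≤s z≤n) (s≤s (subst (_< m) (sym (Fin.toℕ-inject₁ i)) (Fin.toℕ<n i)))))
    term-zero : term Fin.zero ≡ 1
    term-zero = begin
      1 * (1 * 1 ^ₛ p) ≡⟨ trans (ℕ.*-identityˡ _) (ℕ.*-identityˡ _) ⟩
      1 ^ₛ p           ≡⟨ trans (^ₛ≡^ 1 p) (ℕ.^-zeroˡ p) ⟩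
      1                ∎
    term-top : term top ≡ a ^ p
    term-top = begin
      (p C suc (toℕ (fromℕ m))) ×ₛ (a ^ₛ suc (toℕ (fromℕ m)) * 1 ^ₛ (m ∸ toℕ (fromℕ m)))
        ≡⟨ cong (λ k → (p C suc k) ×ₛ (a ^ₛ suc k * 1 ^ₛ (m ∸ k))) (Fin.toℕ-fromℕ m) ⟩
      (p C p) ×ₛ (a ^ₛ p * 1 ^ₛ (m ∸ m))
        ≡⟨ ×≡* (p C p) _ ⟩
      (p C p) * (a ^ₛ p * 1 ^ₛ (m ∸ m))
        ≡⟨ cong₂ (λ c k → c * (a ^ₛ p * 1 ^ₛ k)) (nCn≡1 p) (ℕ.n∸n≡0 m) ⟩
      1 * (a ^ₛ p * 1)
        ≡⟨ trans (ℕ.*-identityˡ _) (trans (ℕ.*-identityʳ _) (^ₛ≡^ a p)) ⟩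
      a ^ p ∎
    open ℕ._∣_ (∣-sum middle p∣middle) renaming (quotient to t; equality to sum≡t*p)

  fermat : ∀ {p} → Prime p → ∀ a → ∃[ t ] a ^ p ≡ a + t * p
  fermat {zero}  p-prime _ = contradiction p-prime ¬prime[0]
  fermat {suc m} p-prime zero = 0 , refl
  fermat {suc m} p-prime (suc a) with fermat p-prime a | freshmans-dream p-prime a
  ... | s , aᵖ≡a+sp | t , [a+1]ᵖ≡1+tp+aᵖ = s + t , (begin
    suc a ^ p             ≡⟨ cong (_^ p) (ℕ.+-comm 1 a) ⟩
    (a + 1) ^ p           ≡⟨ [a+1]ᵖ≡1+tp+aᵖ ⟩
    1 + (t * p + a ^ p)   ≡⟨ cong (λ x → 1 + (t * p + x)) aᵖ≡a+sp ⟩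
    1 + (t * p + (a + s * p)) ≡⟨ rearrange a s t p ⟩
    suc a + (s + t) * p   ∎)
    where
    open ≡-Reasoning
    p = suc m
    rearrange : ∀ a s t p → 1 + (t * p + (a + s * p)) ≡ suc a + (s + t) * p
    rearrange = ℕ-Solver.solve-∀

module LocalObstructions where

  open import Data.Nat as ℕ using (ℕ; zero; suc)
  import Data.Nat.Properties as ℕ
  import Data.Nat.Divisibility as ℕ
  import Data.Nat.DivMod as ℕ
  import Data.Nat.Tactic.RingSolver as ℕ-Solver
  open import Data.Nat.Primality using (Prime; prime⇒nonZero; euclidsLemma; ¬prime[1]; prime[2])
  open import Data.Integer as ℤ using (ℤ; +_; 1ℤ; _+_; _-_; _*_; -_; _^_)
  import Data.Integer.Properties as ℤ
  import Data.Integer.DivMod as ℤ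
  import Data.Sign.Properties as Sign
  open import Data.Integer.Divisibility.Signed
  open import Data.Integer.Tactic.RingSolver using (solve-∀; solve)
  open import Data.List using (_∷_; [])
  open import Data.Product using (∃-syntax; _×_; _,_; proj₁; proj₂)
  open import Data.Sum using (_⊎_; inj₁; inj₂; [_,_]′)
  open import Data.Empty using (⊥; ⊥-elim)
  open import Function using (_∘_)
  open import Relation.Nullary using (¬_; Dec; contradiction; yes; no)
  open import Relation.Binary.PropositionalEquality
  open Fermat using (fermat)

  n∣m*n : ∀ m n → n ∣ m * n
  n∣m*n m n = divides m refl

  m*n∣⇒n∣ : ∀ m {n x} → m * n ∣ x → n ∣ x
  m*n∣⇒n∣ m {n} = ∣-trans (n∣m*n m n)

  *-pres-∣ : ∀ {m n x y} → m ∣ x → n ∣ y → m * n ∣ x * y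
  *-pres-∣ {m} {n} {x} {y} m∣x n∣y =
    ∣ᵤ⇒∣ (subst₂ ℕ._∣_ (sym (ℤ.abs-* m n)) (sym (ℤ.abs-* x y)) (ℕ.*-pres-∣ (∣⇒∣ᵤ m∣x) (∣⇒∣ᵤ n∣y)))

  ∣-≡ : ∀ {d x y} → d ∣ x → x ≡ y → d ∣ y
  ∣-≡ d∣x refl = d∣x

  ∣-linear₂ : ∀ {d x y z} s t → d ∣ x → d ∣ y → z ≡ s * x + t * y → d ∣ z
  ∣-linear₂ s t d∣x d∣y refl = ∣m∣n⇒∣m+n (∣n⇒∣m*n s d∣x) (∣n⇒∣m*n t d∣y)

  ∣-linear₃ : ∀ {d x y v z} s t u → d ∣ x → d ∣ y → d ∣ v → z ≡ s * x + t * y + u * v → d ∣ z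
  ∣-linear₃ s t u d∣x d∣y d∣v refl = ∣m∣n⇒∣m+n (∣-linear₂ s t d∣x d∣y refl) (∣n⇒∣m*n u d∣v)

  ∣-^ : ∀ {d u v} → d ∣ u - v → ∀ k → d ∣ u ^ k - v ^ k
  ∣-^ {d} _ zero = divides ℤ.0ℤ (trans (ℤ.+-inverseʳ 1ℤ) (sym (ℤ.*-zeroˡ d)))
  ∣-^ {u = u} {v} d∣u-v (suc k) = ∣-linear₂ u (v ^ k) (∣-^ d∣u-v k) d∣u-v (split u v (u ^ k) (v ^ k))
    where
    split : ∀ u v uᵏ vᵏ → u * uᵏ - v * vᵏ ≡ u * (uᵏ - vᵏ) + vᵏ * (u - v)
    split = solve-∀

  pos-^ : ∀ m n → + (m ℕ.^ n) ≡ (+ m) ^ n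
  pos-^ m zero    = refl
  pos-^ m (suc n) = trans (ℤ.pos-* m (m ℕ.^ n)) (cong (_*_ (+ m)) (pos-^ m n))

  -^-odd : ∀ v g → (- v) ^ suc (2 ℕ.* g) ≡ - (v ^ suc (2 ℕ.* g))
  -^-odd v g = begin
    - v * (- v) ^ (2 ℕ.* g)   ≡⟨ cong (- v *_) (sym (ℤ.^-*-assoc (- v) 2 g)) ⟩
    - v * ((- v) ^ 2) ^ g     ≡⟨ cong (λ w → - v * w ^ g) (square-neg v) ⟩
    - v * (v ^ 2) ^ g         ≡⟨ cong (- v *_) (ℤ.^-*-assoc v 2 g) ⟩
    - v * v ^ (2 ℕ.* g)       ≡⟨ ℤ.neg-distribˡ-* v _ ⟨
    - (v * v ^ (2 ℕ.* g))     ∎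
    where
    open ≡-Reasoning
    square-neg : ∀ v → - v * (- v * 1ℤ) ≡ v * (v * 1ℤ)
    square-neg = solve-∀

  x*x≡+∣x∣*∣x∣ : ∀ x → x * x ≡ + (ℤ.∣ x ∣ ℕ.* ℤ.∣ x ∣)
  x*x≡+∣x∣*∣x∣ x = trans (cong (ℤ._◃ (ℤ.∣ x ∣ ℕ.* ℤ.∣ x ∣)) (Sign.s*s≡+ (ℤ.sign x))) (ℤ.+◃n≡+n _)

  -- The two forms of HasQₗPoint; inlined so that the ring solver sees through them.
  Q₁ : (B₁ B₂ a₀ a₁ a₂ : ℤ) → ℤ
  Q₁ B₁ B₂ a₀ a₁ a₂ = B₁ * a₁ * a₁ - B₂ * a₂ * a₂ - a₀ * a₀
  {-# INLINE Q₁ #-}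

  Q₂ : (B₁ B₂ N a₀ a₁ a₃ : ℤ) → ℤ
  Q₂ B₁ B₂ N a₀ a₁ a₃ = B₁ * a₁ * a₁ - B₁ * B₂ * a₃ * a₃ + N * N * a₀ * a₀
  {-# INLINE Q₂ #-}

  infix 4 _∥_
  _∥_ : ℤ → ℤ → Set
  d ∥ x = ∃[ c ] x ≡ c * d × ¬ d ∣ c

  AllSolutionsDivisible : (m d B₁ B₂ N : ℤ) → Set
  AllSolutionsDivisible m d B₁ B₂ N = ∀ a₀ a₁ a₂ a₃ → m ∣ Q₁ B₁ B₂ a₀ a₁ a₂ → m ∣ Q₂ B₁ B₂ N a₀ a₁ a₃ →
                                      d ∣ a₀ × d ∣ a₁ × d ∣ a₂ × d ∣ a₃

  AllSolutionsDivisible-p²⇒p³ : ∀ {P B₁ B₂ N} → AllSolutionsDivisible (P * P) P B₁ B₂ N →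
                                AllSolutionsDivisible (P * (P * P)) P B₁ B₂ N
  AllSolutionsDivisible-p²⇒p³ {P} key a₀ a₁ a₂ a₃ h₁ h₂ = key a₀ a₁ a₂ a₃ (m*n∣⇒n∣ P h₁) (m*n∣⇒n∣ P h₂)

  Q₁-homogeneous : ∀ B₁ B₂ L x₀ x₁ x₂ → Q₁ B₁ B₂ (x₀ * L) (x₁ * L) (x₂ * L) ≡ L * (L * Q₁ B₁ B₂ x₀ x₁ x₂)
  Q₁-homogeneous = solve-∀

  Q₂-homogeneous : ∀ B₁ B₂ N L x₀ x₁ x₃ → Q₂ B₁ B₂ N (x₀ * L) (x₁ * L) (x₃ * L) ≡ L * (L * Q₂ B₁ B₂ N x₀ x₁ x₃)
  Q₂-homogeneous = solve-∀

  module _ {l} .{{_ : ℕ.NonZero l}} where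

    private
      L = + l

      +l^[2+e] : ∀ e → + (l ℕ.^ suc (suc e)) ≡ L * (L * + (l ℕ.^ e))
      +l^[2+e] e = trans (ℤ.pos-* l _) (cong (L *_) (ℤ.pos-* l _))

      l³∣l^[2j+3] : ∀ j → L * (L * L) ∣ + (l ℕ.^ (j ℕ.* 2 ℕ.+ 3))
      l³∣l^[2j+3] j =
        subst (_∣ + (l ℕ.^ (j ℕ.* 2 ℕ.+ 3))) +l³ (∣ᵤ⇒∣ (subst (ℕ._∣_ (l ℕ.^ 3)) (sym l^[2j+3]) (ℕ.m∣m*n _)))
        where
        +l³ : + (l ℕ.^ 3) ≡ L * (L * L)
        +l³ = trans (+l^[2+e] 1) (cong (λ x → L * (L * x)) (cong +_ (ℕ.*-identityʳ l)))
        l^[2j+3] : l ℕ.^ (j ℕ.* 2 ℕ.+ 3) ≡ l ℕ.^ 3 ℕ.* l ℕ.^ (j ℕ.* 2)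
        l^[2j+3] = trans (cong (l ℕ.^_) (ℕ.+-comm (j ℕ.* 2) 3)) (ℕ.^-distribˡ-+-* l 3 (j ℕ.* 2))

    -- Dividing a solution by l lowers the power of l dividing the forms by two.
    descent : ∀ {B₁ B₂ N} → AllSolutionsDivisible (L * (L * L)) L B₁ B₂ N →
              ∀ j a₀ a₁ a₂ a₃ → + (l ℕ.^ (j ℕ.* 2 ℕ.+ 3)) ∣ Q₁ B₁ B₂ a₀ a₁ a₂ →
              + (l ℕ.^ (j ℕ.* 2 ℕ.+ 3)) ∣ Q₂ B₁ B₂ N a₀ a₁ a₃ → + (l ℕ.^ suc j) ∣ a₀
    descent key zero a₀ a₁ a₂ a₃ h₁ h₂ =
      subst (_∣ a₀) (cong +_ (sym (ℕ.*-identityʳ l))) (proj₁ (key a₀ a₁ a₂ a₃ (l³ h₁) (l³ h₂)))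
      where
      l³ : ∀ {x} → + (l ℕ.^ 3) ∣ x → L * (L * L) ∣ x
      l³ = ∣-trans (l³∣l^[2j+3] 0)
    descent {B₁} {B₂} {N} key (suc j) a₀ a₁ a₂ a₃ h₁ h₂
      with key a₀ a₁ a₂ a₃ (∣-trans (l³∣l^[2j+3] (suc j)) h₁) (∣-trans (l³∣l^[2j+3] (suc j)) h₂)
    ... | divides x₀ refl , divides x₁ refl , divides x₂ refl , divides x₃ refl =
      subst₂ _∣_ (sym (ℤ.pos-* l (l ℕ.^ suc j))) (ℤ.*-comm L x₀) (*-monoʳ-∣ L lʲ⁺¹∣x₀)
      where
      e = j ℕ.* 2 ℕ.+ 3
      reduce : ∀ {x} y → + (l ℕ.^ suc (suc e)) ∣ x → x ≡ L * (L * y) → + (l ℕ.^ e) ∣ y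
      reduce y h refl = *-cancelˡ-∣ L (*-cancelˡ-∣ L (subst (_∣ L * (L * y)) (+l^[2+e] e) h))
      lʲ⁺¹∣x₀ : + (l ℕ.^ suc j) ∣ x₀
      lʲ⁺¹∣x₀ = descent {B₁} {B₂} {N} key j x₀ x₁ x₂ x₃ (reduce _ h₁ (Q₁-homogeneous B₁ B₂ L x₀ x₁ x₂))
                                          (reduce _ h₂ (Q₂-homogeneous B₁ B₂ N L x₀ x₁ x₃))

    ∣-seq-diff : (w : ℤ_ l) → ∀ d k → + (l ℕ.^ k) ∣ seq w (d ℕ.+ k) - seq w k
    ∣-seq-diff w zero    k = divides ℤ.0ℤ (ℤ.+-inverseʳ (seq w k))
    ∣-seq-diff w (suc d) k =
      ∣-linear₂ 1ℤ 1ℤ (∣-trans lᵏ∣lᵈ⁺ᵏ (∣ᵤ⇒∣ {i = seq w (suc d ℕ.+ k) - seq w (d ℕ.+ k)} (coh w (d ℕ.+ k))))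
        (∣-seq-diff w d k) (telescope (seq w (suc d ℕ.+ k)) (seq w (d ℕ.+ k)) (seq w k))
      where
      lᵏ∣lᵈ⁺ᵏ : + (l ℕ.^ k) ∣ + (l ℕ.^ (d ℕ.+ k))
      lᵏ∣lᵈ⁺ᵏ = ∣ᵤ⇒∣ (subst (ℕ._∣_ (l ℕ.^ k)) (sym (ℕ.^-distribˡ-+-* l d k)) (ℕ.n∣m*n (l ℕ.^ d)))
      telescope : ∀ a b c → a - c ≡ 1ℤ * (a - b) + 1ℤ * (b - c)
      telescope = solve-∀

    no-ℚₗ-point : ∀ {b₁ b₂ n} → AllSolutionsDivisible (L * (L * L)) L (+ b₁) (+ b₂) (+ n) →
                  ¬ HasQₗPoint l b₁ b₂ n
    no-ℚₗ-point {b₁} {b₂} {n} key (w₀ , w₁ , w₂ , w₃ , (K , lᴷ∤w₀ᴷ) , solution) = lᴷ∤w₀ᴷ (∣⇒∣ᵤ lᴷ∣w₀ᴷ)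
      where
      k = K ℕ.* 2 ℕ.+ 3
      lᴷ⁺¹∣w₀ᵏ : + (l ℕ.^ suc K) ∣ seq w₀ k
      lᴷ⁺¹∣w₀ᵏ = descent {+ b₁} {+ b₂} {+ n} key K (seq w₀ k) (seq w₁ k) (seq w₂ k) (seq w₃ k)
                   (∣ᵤ⇒∣ (proj₁ (solution k))) (∣ᵤ⇒∣ (proj₂ (solution k)))
      lᴷ∣w₀ᵏ : + (l ℕ.^ K) ∣ seq w₀ k
      lᴷ∣w₀ᵏ = ∣-trans (subst (+ (l ℕ.^ K) ∣_) (sym (ℤ.pos-* l (l ℕ.^ K))) (n∣m*n L _)) lᴷ⁺¹∣w₀ᵏ
      k≡[K+3]+K : k ≡ (K ℕ.+ 3) ℕ.+ K
      k≡[K+3]+K = rearrange K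
        where
        rearrange : ∀ K → K ℕ.* 2 ℕ.+ 3 ≡ (K ℕ.+ 3) ℕ.+ K
        rearrange = ℕ-Solver.solve-∀
      lᴷ∣w₀ᵏ-w₀ᴷ : + (l ℕ.^ K) ∣ seq w₀ k - seq w₀ K
      lᴷ∣w₀ᵏ-w₀ᴷ = subst (λ i → + (l ℕ.^ K) ∣ seq w₀ i - seq w₀ K) (sym k≡[K+3]+K) (∣-seq-diff w₀ (K ℕ.+ 3) K)
      lᴷ∣w₀ᴷ : + (l ℕ.^ K) ∣ seq w₀ K
      lᴷ∣w₀ᴷ = subst (_ ∣_) (cancel (seq w₀ k) (seq w₀ K)) (∣m∣n⇒∣m-n lᴷ∣w₀ᵏ lᴷ∣w₀ᵏ-w₀ᴷ)
        where
        cancel : ∀ a b → a - (a - b) ≡ b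
        cancel = solve-∀

  ∣Q⇒∣[1+N²]a₀² : ∀ {d} B₁ B₂ N a₀ a₁ a₂ a₃ →
                  d ∣ Q₁ B₁ B₂ a₀ a₁ a₂ → d ∣ Q₂ B₁ B₂ N a₀ a₁ a₃ → d ∣ B₂ → d ∣ (1ℤ + N * N) * (a₀ * a₀)
  ∣Q⇒∣[1+N²]a₀² B₁ B₂ N a₀ a₁ a₂ a₃ h₁ h₂ d∣B₂ =
    ∣-linear₃ (- 1ℤ) 1ℤ (B₁ * (a₃ * a₃) - a₂ * a₂) h₁ h₂ d∣B₂ (solve (B₁ ∷ B₂ ∷ N ∷ a₀ ∷ a₁ ∷ a₂ ∷ a₃ ∷ []))

  ∣Q₁⇒∣B₁a₁² : ∀ {d} B₁ B₂ a₀ a₁ a₂ →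
               d ∣ Q₁ B₁ B₂ a₀ a₁ a₂ → d ∣ B₂ * (a₂ * a₂) → d ∣ a₀ * a₀ → d ∣ B₁ * (a₁ * a₁)
  ∣Q₁⇒∣B₁a₁² B₁ B₂ a₀ a₁ a₂ h d∣x d∣y =
    ∣-linear₃ 1ℤ 1ℤ 1ℤ h d∣x d∣y (solve (B₁ ∷ B₂ ∷ a₀ ∷ a₁ ∷ a₂ ∷ []))

  ∣Q₁⇒∣B₂a₂² : ∀ {d} B₁ B₂ a₀ a₁ a₂ →
               d ∣ Q₁ B₁ B₂ a₀ a₁ a₂ → d ∣ B₁ * (a₁ * a₁) → d ∣ a₀ * a₀ → d ∣ B₂ * (a₂ * a₂)
  ∣Q₁⇒∣B₂a₂² B₁ B₂ a₀ a₁ a₂ h d∣x d∣y =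
    ∣-linear₃ (- 1ℤ) 1ℤ (- 1ℤ) h d∣x d∣y (solve (B₁ ∷ B₂ ∷ a₀ ∷ a₁ ∷ a₂ ∷ []))

  ∣Q₁⇒∣a₀² : ∀ {d} B₁ B₂ a₀ a₁ a₂ →
             d ∣ Q₁ B₁ B₂ a₀ a₁ a₂ → d ∣ B₁ * (a₁ * a₁) → d ∣ B₂ * (a₂ * a₂) → d ∣ a₀ * a₀
  ∣Q₁⇒∣a₀² B₁ B₂ a₀ a₁ a₂ h d∣x d∣y =
    ∣-linear₃ (- 1ℤ) 1ℤ (- 1ℤ) h d∣x d∣y (solve (B₁ ∷ B₂ ∷ a₀ ∷ a₁ ∷ a₂ ∷ []))

  ∣Q₁⇒∣a₀²+a₂² : ∀ {d} B₁ a₀ a₁ a₂ → d ∣ Q₁ B₁ 1ℤ a₀ a₁ a₂ → d ∣ B₁ * (a₁ * a₁) → d ∣ a₀ * a₀ + a₂ * a₂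
  ∣Q₁⇒∣a₀²+a₂² B₁ a₀ a₁ a₂ h d∣x = ∣-linear₂ (- 1ℤ) 1ℤ h d∣x (solve (B₁ ∷ a₀ ∷ a₁ ∷ a₂ ∷ []))

  ∣Q₂⇒∣B₁a₁² : ∀ {d} B₁ B₂ N a₀ a₁ a₃ →
               d ∣ Q₂ B₁ B₂ N a₀ a₁ a₃ → d ∣ B₁ * (B₂ * (a₃ * a₃)) → d ∣ N * N * (a₀ * a₀) → d ∣ B₁ * (a₁ * a₁)
  ∣Q₂⇒∣B₁a₁² B₁ B₂ N a₀ a₁ a₃ h d∣x d∣y =
    ∣-linear₃ 1ℤ 1ℤ (- 1ℤ) h d∣x d∣y (solve (B₁ ∷ B₂ ∷ N ∷ a₀ ∷ a₁ ∷ a₃ ∷ []))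

  ∣Q₂⇒∣B₁B₂a₃² : ∀ {d} B₁ B₂ N a₀ a₁ a₃ →
                 d ∣ Q₂ B₁ B₂ N a₀ a₁ a₃ → d ∣ B₁ * (a₁ * a₁) → d ∣ N * N * (a₀ * a₀) → d ∣ B₁ * (B₂ * (a₃ * a₃))
  ∣Q₂⇒∣B₁B₂a₃² B₁ B₂ N a₀ a₁ a₃ h d∣x d∣y =
    ∣-linear₃ (- 1ℤ) 1ℤ 1ℤ h d∣x d∣y (solve (B₁ ∷ B₂ ∷ N ∷ a₀ ∷ a₁ ∷ a₃ ∷ []))

  ∣Q₂⇒∣N²a₀² : ∀ {d} B₁ B₂ N a₀ a₁ a₃ →
               d ∣ Q₂ B₁ B₂ N a₀ a₁ a₃ → d ∣ B₁ * (a₁ * a₁) → d ∣ B₁ * (B₂ * (a₃ * a₃)) → d ∣ N * N * (a₀ * a₀)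
  ∣Q₂⇒∣N²a₀² B₁ B₂ N a₀ a₁ a₃ h d∣x d∣y =
    ∣-linear₃ 1ℤ (- 1ℤ) 1ℤ h d∣x d∣y (solve (B₁ ∷ B₂ ∷ N ∷ a₀ ∷ a₁ ∷ a₃ ∷ []))

  module _ {P : ℤ} (P-euclid : ∀ x y → P ∣ x * y → P ∣ x ⊎ P ∣ y) where

    ∤-cancelˡ : ∀ {u v} → ¬ P ∣ u → P ∣ u * v → P ∣ v
    ∤-cancelˡ {u} {v} p∤u h with P-euclid u v h
    ... | inj₁ p∣u = contradiction p∣u p∤u
    ... | inj₂ p∣v = p∣v

    ∣²⇒∣ : ∀ {x} → P ∣ x * x → P ∣ x
    ∣²⇒∣ {x} h with P-euclid x x h
    ... | inj₁ p∣x = p∣x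
    ... | inj₂ p∣x = p∣x

    ∣unit*²⇒∣ : ∀ {u} x → ¬ P ∣ u → P ∣ u * (x * x) → P ∣ x
    ∣unit*²⇒∣ x p∤u = ∣²⇒∣ ∘ ∤-cancelˡ p∤u

    module _ .{{_ : ℤ.NonZero P}} where

      private
        p²∣⇒p∣ : ∀ {x} → P * P ∣ x → P ∣ x
        p²∣⇒p∣ = m*n∣⇒n∣ P

        p³∣⇒p²∣ : ∀ {x} → P * (P * P) ∣ x → P * P ∣ x
        p³∣⇒p²∣ = m*n∣⇒n∣ P

        p²∣² : ∀ {x} → P ∣ x → P * P ∣ x * x
        p²∣² p∣x = *-pres-∣ p∣x p∣x

      ∥⇒∣ : ∀ {B} → P ∥ B → P ∣ B
      ∥⇒∣ (C , B≡CP , _) = divides C B≡CP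

      ∥-cancel : ∀ {B x} → P ∥ B → P * P ∣ B * x → P ∣ x
      ∥-cancel {x = x} (C , refl , p∤C) h = ∤-cancelˡ p∤C (*-cancelˡ-∣ P (∣-≡ h (solve (C ∷ P ∷ x ∷ []))))

      ∥∥-cancel : ∀ {B₁ B₂ x} → P ∥ B₁ → P ∥ B₂ → P * (P * P) ∣ B₁ * (B₂ * x) → P ∣ x
      ∥∥-cancel {x = x} (C₁ , refl , p∤C₁) (C₂ , refl , p∤C₂) h =
        ∤-cancelˡ p∤C₂ (∤-cancelˡ p∤C₁ (*-cancelˡ-∣ P (*-cancelˡ-∣ P (∣-≡ h (solve (C₁ ∷ C₂ ∷ P ∷ x ∷ []))))))

      solutions-p∥B₂ : ∀ {B₁ B₂ N} → ¬ P ∣ B₁ → P ∥ B₂ → ¬ P ∣ 1ℤ + N * N →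
                       AllSolutionsDivisible (P * P) P B₁ B₂ N
      solutions-p∥B₂ {B₁} {B₂} {N} p∤B₁ p∥B₂ p∤1+N² a₀ a₁ a₂ a₃ h₁ h₂ = p∣a₀ , p∣a₁ , p∣a₂ , p∣a₃
        where
        p∣B₂ : P ∣ B₂
        p∣B₂ = ∥⇒∣ p∥B₂
        p∣a₀ : P ∣ a₀
        p∣a₀ = ∣unit*²⇒∣ a₀ p∤1+N²
                 (∣Q⇒∣[1+N²]a₀² B₁ B₂ N a₀ a₁ a₂ a₃ (p²∣⇒p∣ h₁) (p²∣⇒p∣ h₂) p∣B₂)
        p∣a₁ : P ∣ a₁
        p∣a₁ = ∣unit*²⇒∣ a₁ p∤B₁
                 (∣Q₁⇒∣B₁a₁² B₁ B₂ a₀ a₁ a₂ (p²∣⇒p∣ h₁) (∣m⇒∣m*n (a₂ * a₂) p∣B₂) (∣m⇒∣m*n a₀ p∣a₀))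
        p∣a₂ : P ∣ a₂
        p∣a₂ = ∣²⇒∣ (∥-cancel p∥B₂
                 (∣Q₁⇒∣B₂a₂² B₁ B₂ a₀ a₁ a₂ h₁ (∣n⇒∣m*n B₁ (p²∣² p∣a₁)) (p²∣² p∣a₀)))
        p∣a₃ : P ∣ a₃
        p∣a₃ = ∣unit*²⇒∣ a₃ p∤B₁ (∥-cancel p∥B₂ (∣-≡
                 (∣Q₂⇒∣B₁B₂a₃² B₁ B₂ N a₀ a₁ a₃ h₂ (∣n⇒∣m*n B₁ (p²∣² p∣a₁)) (∣n⇒∣m*n (N * N) (p²∣² p∣a₀)))
                 (solve (B₁ ∷ B₂ ∷ a₃ ∷ []))))

      solutions-p∥B₁-p∥B₂-p∣N : ∀ {B₁ B₂ N} → P ∥ B₁ → P ∥ B₂ → P ∣ N →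
                                AllSolutionsDivisible (P * (P * P)) P B₁ B₂ N
      solutions-p∥B₁-p∥B₂-p∣N {B₁} {B₂} {N} p∥B₁ p∥B₂ p∣N a₀ a₁ a₂ a₃ h₁ h₂ = p∣a₀ , p∣a₁ , p∣a₂ , p∣a₃
        where
        p∣B₁ : P ∣ B₁
        p∣B₁ = ∥⇒∣ p∥B₁
        p∣B₂ : P ∣ B₂
        p∣B₂ = ∥⇒∣ p∥B₂
        p∣a₀ : P ∣ a₀
        p∣a₀ = ∣²⇒∣ (∣Q₁⇒∣a₀² B₁ B₂ a₀ a₁ a₂ (p²∣⇒p∣ (p³∣⇒p²∣ h₁))
                 (∣m⇒∣m*n (a₁ * a₁) p∣B₁) (∣m⇒∣m*n (a₂ * a₂) p∣B₂))
        p∣a₁ : P ∣ a₁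
        p∣a₁ = ∣²⇒∣ (∥-cancel p∥B₁ (∣Q₂⇒∣B₁a₁² B₁ B₂ N a₀ a₁ a₃ (p³∣⇒p²∣ h₂)
                 (*-pres-∣ p∣B₁ (∣m⇒∣m*n (a₃ * a₃) p∣B₂)) (∣m⇒∣m*n (a₀ * a₀) (*-pres-∣ p∣N p∣N))))
        p∣a₂ : P ∣ a₂
        p∣a₂ = ∣²⇒∣ (∥-cancel p∥B₂ (∣Q₁⇒∣B₂a₂² B₁ B₂ a₀ a₁ a₂ (p³∣⇒p²∣ h₁)
                 (∣n⇒∣m*n B₁ (p²∣² p∣a₁)) (p²∣² p∣a₀)))
        p∣a₃ : P ∣ a₃
        p∣a₃ = ∣²⇒∣ (∥∥-cancel p∥B₁ p∥B₂ (∣Q₂⇒∣B₁B₂a₃² B₁ B₂ N a₀ a₁ a₃ h₂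
                 (*-pres-∣ p∣B₁ (p²∣² p∣a₁)) (*-pres-∣ (∣m⇒∣m*n N p∣N) (p²∣² p∣a₀))))

      solutions-p∥B₁-p∣a₀ : ∀ {B₁ B₂ N} → P ∥ B₁ → ¬ P ∣ B₂ → ∀ a₀ a₁ a₂ a₃ →
                            P * P ∣ Q₁ B₁ B₂ a₀ a₁ a₂ → P * P ∣ Q₂ B₁ B₂ N a₀ a₁ a₃ → P ∣ a₀ →
                            P ∣ a₀ × P ∣ a₁ × P ∣ a₂ × P ∣ a₃
      solutions-p∥B₁-p∣a₀ {B₁} {B₂} {N} p∥B₁ p∤B₂ a₀ a₁ a₂ a₃ h₁ h₂ p∣a₀ = p∣a₀ , p∣a₁ , p∣a₂ , p∣a₃
        where
        p∣a₂ : P ∣ a₂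
        p∣a₂ = ∣unit*²⇒∣ a₂ p∤B₂ (∣Q₁⇒∣B₂a₂² B₁ B₂ a₀ a₁ a₂ (p²∣⇒p∣ h₁)
                 (∣m⇒∣m*n (a₁ * a₁) (∥⇒∣ p∥B₁)) (∣m⇒∣m*n a₀ p∣a₀))
        p∣a₁ : P ∣ a₁
        p∣a₁ = ∣²⇒∣ (∥-cancel p∥B₁
                 (∣Q₁⇒∣B₁a₁² B₁ B₂ a₀ a₁ a₂ h₁ (∣n⇒∣m*n B₂ (p²∣² p∣a₂)) (p²∣² p∣a₀)))
        p∣a₃ : P ∣ a₃
        p∣a₃ = ∣unit*²⇒∣ a₃ p∤B₂ (∥-cancel p∥B₁
                 (∣Q₂⇒∣B₁B₂a₃² B₁ B₂ N a₀ a₁ a₃ h₂ (∣n⇒∣m*n B₁ (p²∣² p∣a₁)) (∣n⇒∣m*n (N * N) (p²∣² p∣a₀))))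

      solutions-p∥B₁-p∤N : ∀ {B₁ B₂ N} → P ∥ B₁ → ¬ P ∣ B₂ → ¬ P ∣ N →
                           AllSolutionsDivisible (P * P) P B₁ B₂ N
      solutions-p∥B₁-p∤N {B₁} {B₂} {N} p∥B₁ p∤B₂ p∤N a₀ a₁ a₂ a₃ h₁ h₂ =
        solutions-p∥B₁-p∣a₀ {N = N} p∥B₁ p∤B₂ a₀ a₁ a₂ a₃ h₁ h₂ (∣unit*²⇒∣ a₀ (p∤N ∘ ∣²⇒∣)
          (∣Q₂⇒∣N²a₀² B₁ B₂ N a₀ a₁ a₃ (p²∣⇒p∣ h₂) (∣m⇒∣m*n (a₁ * a₁) (∥⇒∣ p∥B₁))
            (∣m⇒∣m*n (B₂ * (a₃ * a₃)) (∥⇒∣ p∥B₁))))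

      solutions-p∥B₁-B₂≡1 : ∀ {B₁ N} → ¬ P ∣ 1ℤ → (∀ x y → P ∣ x * x + y * y → P ∣ x) → P ∥ B₁ →
                            AllSolutionsDivisible (P * P) P B₁ 1ℤ N
      solutions-p∥B₁-B₂≡1 {B₁} {N} p∤1 ∣x²+y²⇒∣x p∥B₁ a₀ a₁ a₂ a₃ h₁ h₂ =
        solutions-p∥B₁-p∣a₀ {N = N} p∥B₁ p∤1 a₀ a₁ a₂ a₃ h₁ h₂
          (∣x²+y²⇒∣x a₀ a₂ (∣Q₁⇒∣a₀²+a₂² B₁ a₀ a₁ a₂ (p²∣⇒p∣ h₁) (∣m⇒∣m*n (a₁ * a₁) (∥⇒∣ p∥B₁))))

  module _ {p} (p-prime : Prime p) where

    private
      P = + p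
      instance _ = prime⇒nonZero p-prime

    ∣*⇒∣⊎∣ : ∀ x y → P ∣ x * y → P ∣ x ⊎ P ∣ y
    ∣*⇒∣⊎∣ x y h with euclidsLemma ℤ.∣ x ∣ ℤ.∣ y ∣ p-prime (subst (ℕ._∣_ p) (ℤ.abs-* x y) (∣⇒∣ᵤ h))
    ... | inj₁ p∣x = inj₁ (∣ᵤ⇒∣ p∣x)
    ... | inj₂ p∣y = inj₂ (∣ᵤ⇒∣ p∣y)

    p∤1 : ¬ P ∣ 1ℤ
    p∤1 p∣1 = ¬prime[1] (subst Prime (ℕ.∣1⇒≡1 (∣⇒∣ᵤ p∣1)) p-prime)

    p∤a⇒p∣aᵖ⁻¹-1 : ∀ {m a} → p ≡ suc m → ¬ P ∣ + a → P ∣ + (a ℕ.^ m) - 1ℤ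
    p∤a⇒p∣aᵖ⁻¹-1 {m} {a} refl p∤a with fermat p-prime a
    ... | t , aᵖ≡a+tp = ∤-cancelˡ ∣*⇒∣⊎∣ p∤a (divides (+ t) (begin
      + a * (+ (a ℕ.^ m) - 1ℤ)      ≡⟨ distrib (+ a) (+ (a ℕ.^ m)) ⟩
      + a * + (a ℕ.^ m) - + a       ≡⟨ cong (_- + a) (ℤ.pos-* a (a ℕ.^ m)) ⟨
      + (a ℕ.^ p) - + a             ≡⟨ cong (λ n → + n - + a) aᵖ≡a+tp ⟩
      + (a ℕ.+ t ℕ.* p) - + a       ≡⟨ cong (_- + a) (trans (ℤ.pos-+ a _) (cong (_+_ (+ a)) (ℤ.pos-* t p))) ⟩
      + a + + t * P - + a           ≡⟨ cancel (+ a) (+ t * P) ⟩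
      + t * P                       ∎))
      where
      open ≡-Reasoning
      distrib : ∀ a x → a * (x - 1ℤ) ≡ a * x - a
      distrib = solve-∀
      cancel : ∀ a x → a + x - a ≡ x
      cancel = solve-∀

    ∣x²+y²⇒∣x : p ℕ.% 4 ≡ 3 → ∀ x y → P ∣ x * x + y * y → P ∣ x
    ∣x²+y²⇒∣x p%4≡3 x y p∣x²+y² with P ∣? x
    ... | yes p∣x = p∣x
    ... | no  p∤x = ⊥-elim (ℕ.<⇒≱ 2<p (ℕ.∣⇒≤ (∣⇒∣ᵤ p∣2)))
      where
      g = p ℕ./ 4
      k = suc (2 ℕ.* g)
      p≡3+4g : p ≡ 3 ℕ.+ g ℕ.* 4
      p≡3+4g = trans (ℕ.m≡m%n+[m/n]*n p 4) (cong (ℕ._+ g ℕ.* 4) p%4≡3)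
      2<p : 2 ℕ.< p
      2<p = subst (2 ℕ.<_) (sym p≡3+4g) (ℕ.m≤m+n 3 (g ℕ.* 4))
      p≡1+2k : p ≡ suc (2 ℕ.* k)
      p≡1+2k = trans p≡3+4g (rearrange g)
        where
        rearrange : ∀ g → 3 ℕ.+ g ℕ.* 4 ≡ suc (2 ℕ.* suc (2 ℕ.* g))
        rearrange = ℕ-Solver.solve-∀
      p∤∣x∣ : ¬ P ∣ + ℤ.∣ x ∣
      p∤∣x∣ p∣∣x∣ = p∤x (∣-trans p∣∣x∣ (∣m∣∣m {x}))
      p∤∣y∣ : ¬ P ∣ + ℤ.∣ y ∣
      p∤∣y∣ p∣∣y∣ =
        p∤x (∣²⇒∣ ∣*⇒∣⊎∣ (∣m+n∣n⇒∣m {m = x * x} p∣x²+y² (∣m⇒∣m*n y (∣-trans p∣∣y∣ (∣m∣∣m {y})))))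
      square^ : ∀ z → (z * z) ^ k ≡ + (ℤ.∣ z ∣ ℕ.^ (2 ℕ.* k))
      square^ z = begin
        (z * z) ^ k                          ≡⟨ cong (_^ k) (x*x≡+∣x∣*∣x∣ z) ⟩
        (+ (ℤ.∣ z ∣ ℕ.* ℤ.∣ z ∣)) ^ k        ≡⟨ pos-^ _ k ⟨
        + ((ℤ.∣ z ∣ ℕ.* ℤ.∣ z ∣) ℕ.^ k)      ≡⟨ cong (λ n → + ((ℤ.∣ z ∣ ℕ.* n) ℕ.^ k)) (sym (ℕ.*-identityʳ _)) ⟩
        + ((ℤ.∣ z ∣ ℕ.^ 2) ℕ.^ k)            ≡⟨ cong +_ (ℕ.^-*-assoc ℤ.∣ z ∣ 2 k) ⟩
        + (ℤ.∣ z ∣ ℕ.^ (2 ℕ.* k))            ∎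
        where open ≡-Reasoning
      A = + (ℤ.∣ x ∣ ℕ.^ (2 ℕ.* k))
      B = + (ℤ.∣ y ∣ ℕ.^ (2 ℕ.* k))
      p∣A+B : P ∣ A - - B
      p∣A+B = subst₂ (λ u v → P ∣ u - v) (square^ x) (trans (-^-odd (y * y) g) (cong -_ (square^ y)))
                (∣-^ {u = x * x} {v = - (y * y)} (subst (P ∣_) (x²+y²≡x²--y² (x * x) (y * y)) p∣x²+y²) k)
        where
        x²+y²≡x²--y² : ∀ u v → u + v ≡ u - - v
        x²+y²≡x²--y² = solve-∀
      p∣2 : P ∣ + 2
      p∣2 = subst (P ∣_) (two A B)
        (∣m∣n⇒∣m-n (∣m∣n⇒∣m-n p∣A+B (p∤a⇒p∣aᵖ⁻¹-1 p≡1+2k p∤∣x∣)) (p∤a⇒p∣aᵖ⁻¹-1 p≡1+2k p∤∣y∣))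
        where
        two : ∀ A B → A - - B - (A - 1ℤ) - (B - 1ℤ) ≡ + 2
        two = solve-∀

  odd⇒2u+1 : ∀ {x} → ¬ + 2 ∣ x → ∃[ u ] x ≡ u * + 2 + 1ℤ
  odd⇒2u+1 {x} 2∤x with x ℤ.% + 2 | ℤ.n%d<d x (+ 2) | ℤ.a≡a%n+[a/n]*n x (+ 2)
  ... | 0 | _ | x≡[x/2]*2 = contradiction (divides (x ℤ./ + 2) (trans x≡[x/2]*2 (ℤ.+-identityˡ (x ℤ./ + 2 * + 2)))) 2∤x
  ... | 1 | _ | x≡1+[x/2]*2 = x ℤ./ + 2 , trans x≡1+[x/2]*2 (ℤ.+-comm 1ℤ (x ℤ./ + 2 * + 2))
  ... | suc (suc _) | ℕ.s≤s (ℕ.s≤s ()) | _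

  odd² : ∀ {x} → ¬ + 2 ∣ x → + 8 ∣ x * x - 1ℤ
  odd² 2∤x with odd⇒2u+1 2∤x
  ... | u , refl with + 2 ∣? u
  ...   | yes (divides v refl) = divides (+ 2 * v * v + v) (u-even v)
    where
    u-even : ∀ v → (v * + 2 * + 2 + 1ℤ) * (v * + 2 * + 2 + 1ℤ) - 1ℤ ≡ (+ 2 * v * v + v) * + 8
    u-even = solve-∀
  ...   | no 2∤u with odd⇒2u+1 2∤u
  ...     | v , refl = divides (+ 2 * v * v + + 3 * v + 1ℤ) (u-odd v)
    where
    u-odd : ∀ v → ((v * + 2 + 1ℤ) * + 2 + 1ℤ) * ((v * + 2 + 1ℤ) * + 2 + 1ℤ) - 1ℤ ≡
                  (+ 2 * v * v + + 3 * v + 1ℤ) * + 8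
    u-odd = solve-∀

  2∤1 : ¬ + 2 ∣ 1ℤ
  2∤1 2∣1 = ℕ.<⇒≱ (ℕ.s≤s (ℕ.s≤s ℕ.z≤n)) (ℕ.∣⇒≤ (∣⇒∣ᵤ 2∣1))

  8∤4 : ¬ + 8 ∣ + 4
  8∤4 8∣4 = ℕ.<⇒≱ (ℕ.s≤s (ℕ.s≤s (ℕ.s≤s (ℕ.s≤s (ℕ.s≤s ℕ.z≤n))))) (ℕ.∣⇒≤ (∣⇒∣ᵤ 8∣4))

  private
    2-euclid : ∀ x y → + 2 ∣ x * y → + 2 ∣ x ⊎ + 2 ∣ y
    2-euclid = ∣*⇒∣⊎∣ prime[2]

  odd-a₀⇒odd-a₂ : ∀ B₁ a₀ a₁ a₂ → + 2 ∣ B₁ → ¬ + 2 ∣ a₀ → + 2 ∣ Q₁ B₁ 1ℤ a₀ a₁ a₂ → ¬ + 2 ∣ a₂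
  odd-a₀⇒odd-a₂ B₁ a₀ a₁ a₂ 2∣B₁ 2∤a₀ h 2∣a₂ = 2∤a₀ (∣²⇒∣ 2-euclid
    (∣m+n∣n⇒∣m (∣Q₁⇒∣a₀²+a₂² B₁ a₀ a₁ a₂ h (∣m⇒∣m*n (a₁ * a₁) 2∣B₁)) (∣m⇒∣m*n a₂ 2∣a₂)))

  odd-a₀⇒odd-a₁ : ∀ C a₀ a₁ a₂ → ¬ + 2 ∣ a₀ → ¬ + 2 ∣ a₂ → + 8 ∣ Q₁ (C * + 2) 1ℤ a₀ a₁ a₂ → ¬ + 2 ∣ a₁
  odd-a₀⇒odd-a₁ C a₀ a₁ a₂ 2∤a₀ 2∤a₂ h 2∣a₁ = 2∤1 (∣-≡ (∣m∣n⇒∣m-n 2∣Ca₁² 2∣Ca₁²-1) (solve (C ∷ a₁ ∷ [])))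
    where
    2∣Ca₁² : + 2 ∣ C * (a₁ * a₁)
    2∣Ca₁² = ∣n⇒∣m*n C (∣m⇒∣m*n a₁ 2∣a₁)
    2∣Ca₁²-1 : + 2 ∣ C * (a₁ * a₁) - 1ℤ
    2∣Ca₁²-1 = m*n∣⇒n∣ (+ 2) (*-cancelˡ-∣ (+ 2) (∣-≡ (∣m∣n⇒∣m+n (∣m∣n⇒∣m+n h (odd² 2∤a₂)) (odd² 2∤a₀))
                 (solve (C ∷ a₀ ∷ a₁ ∷ a₂ ∷ []))))

  -- With a₀ odd, reducing Q₁ mod 8 makes a₁, a₂ odd; then Q₂ ≡ 4 (a₃ odd) or 2 (C + 2) (a₃ even) mod 8.
  8∣Q₂⇒8∣4 : ∀ C M a₀ a₁ a₃ → + 8 ∣ Q₂ (C * + 2) 1ℤ (M * + 2) a₀ a₁ a₃ → + 8 ∣ a₁ * a₁ - 1ℤ →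
              + 8 ∣ a₃ * a₃ - 1ℤ → + 8 ∣ M * a₀ * (M * a₀) - 1ℤ → + 8 ∣ + 4
  8∣Q₂⇒8∣4 C M a₀ a₁ a₃ h 8∣a₁²-1 8∣a₃²-1 8∣[Ma₀]²-1 = ∣-≡
    (∣m∣n⇒∣m-n (∣m∣n⇒∣m+n (∣m∣n⇒∣m-n h (∣n⇒∣m*n (C * + 2) 8∣a₁²-1)) (∣n⇒∣m*n (C * + 2) 8∣a₃²-1))
               (∣n⇒∣m*n (+ 4) 8∣[Ma₀]²-1))
    (identity C M a₀ a₁ a₃)
    where
    identity : ∀ C M a₀ a₁ a₃ → Q₂ (C * + 2) 1ℤ (M * + 2) a₀ a₁ a₃ - C * + 2 * (a₁ * a₁ - 1ℤ)
               + C * + 2 * (a₃ * a₃ - 1ℤ) - + 4 * (M * a₀ * (M * a₀) - 1ℤ) ≡ + 4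
    identity = solve-∀

  8∣Q₂⇒4∣C+2 : ∀ C M a₀ a₁ a₃ → + 8 ∣ Q₂ (C * + 2) 1ℤ (M * + 2) a₀ a₁ a₃ → + 8 ∣ a₁ * a₁ - 1ℤ →
                + 2 ∣ a₃ → + 8 ∣ M * a₀ * (M * a₀) - 1ℤ → + 4 ∣ C + + 2
  8∣Q₂⇒4∣C+2 C M a₀ a₁ a₃ h 8∣a₁²-1 2∣a₃ 8∣[Ma₀]²-1 = *-cancelˡ-∣ (+ 2) (∣-≡
    (∣m∣n⇒∣m-n (∣m∣n⇒∣m+n (∣m∣n⇒∣m-n h (∣n⇒∣m*n (C * + 2) 8∣a₁²-1))
                          (*-pres-∣ (n∣m*n C (+ 2)) (*-pres-∣ 2∣a₃ 2∣a₃)))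
               (∣n⇒∣m*n (+ 4) 8∣[Ma₀]²-1))
    (identity C M a₀ a₁ a₃))
    where
    identity : ∀ C M a₀ a₁ a₃ → Q₂ (C * + 2) 1ℤ (M * + 2) a₀ a₁ a₃ - C * + 2 * (a₁ * a₁ - 1ℤ)
               + C * + 2 * (a₃ * a₃) - + 4 * (M * a₀ * (M * a₀) - 1ℤ) ≡ + 2 * (C + + 2)
    identity = solve-∀

  odd-a₀-impossible : ∀ C M a₀ a₁ a₂ a₃ → ¬ + 2 ∣ C → ¬ + 2 ∣ M → ¬ + 2 ∣ a₀ →
                      + 8 ∣ Q₁ (C * + 2) 1ℤ a₀ a₁ a₂ → ¬ + 8 ∣ Q₂ (C * + 2) 1ℤ (M * + 2) a₀ a₁ a₃
  odd-a₀-impossible C M a₀ a₁ a₂ a₃ 2∤C 2∤M 2∤a₀ h₁ h₂ = by-parity-of-a₃ (+ 2 ∣? a₃)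
    where
    8∣a₁²-1 : + 8 ∣ a₁ * a₁ - 1ℤ
    8∣a₁²-1 = odd² (odd-a₀⇒odd-a₁ C a₀ a₁ a₂ 2∤a₀
                (odd-a₀⇒odd-a₂ (C * + 2) a₀ a₁ a₂ (n∣m*n C (+ 2)) 2∤a₀ (m*n∣⇒n∣ (+ 4) h₁)) h₁)
    8∣[Ma₀]²-1 : + 8 ∣ M * a₀ * (M * a₀) - 1ℤ
    8∣[Ma₀]²-1 = odd² {M * a₀} ([ 2∤M , 2∤a₀ ]′ ∘ 2-euclid M a₀)
    by-parity-of-a₃ : Dec (+ 2 ∣ a₃) → ⊥
    by-parity-of-a₃ (no 2∤a₃)  = 8∤4 (8∣Q₂⇒8∣4 C M a₀ a₁ a₃ h₂ 8∣a₁²-1 (odd² 2∤a₃) 8∣[Ma₀]²-1)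
    by-parity-of-a₃ (yes 2∣a₃) =
      2∤C (∣m+n∣n⇒∣m (m*n∣⇒n∣ (+ 2) (8∣Q₂⇒4∣C+2 C M a₀ a₁ a₃ h₂ 8∣a₁²-1 2∣a₃ 8∣[Ma₀]²-1)) ∣-refl)

  solutions-2∥B₁-2∥N : ∀ {B₁ N} → + 2 ∥ B₁ → + 2 ∥ N → AllSolutionsDivisible (+ 8) (+ 2) B₁ 1ℤ N
  solutions-2∥B₁-2∥N 2∥B₁@(C , refl , 2∤C) (M , refl , 2∤M) a₀ a₁ a₂ a₃ h₁ h₂ = by-parity-of-a₀ (+ 2 ∣? a₀)
    where
    by-parity-of-a₀ : Dec (+ 2 ∣ a₀) → + 2 ∣ a₀ × + 2 ∣ a₁ × + 2 ∣ a₂ × + 2 ∣ a₃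
    by-parity-of-a₀ (yes 2∣a₀) =
      solutions-p∥B₁-p∣a₀ 2-euclid {N = M * + 2} 2∥B₁ 2∤1 a₀ a₁ a₂ a₃
        (m*n∣⇒n∣ (+ 2) h₁) (m*n∣⇒n∣ (+ 2) h₂) 2∣a₀
    by-parity-of-a₀ (no 2∤a₀) = contradiction h₂ (odd-a₀-impossible C M a₀ a₁ a₂ a₃ 2∤C 2∤M 2∤a₀ h₁)

  ∣⇒+∣+ : ∀ {m n} → m ℕ.∣ n → + m ∣ + n
  ∣⇒+∣+ = ∣ᵤ⇒∣

  +∣+⇒∣ : ∀ {m n} → + m ∣ + n → m ℕ.∣ n
  +∣+⇒∣ = ∣⇒∣ᵤ

  squarefree⇒∥ : ∀ {m p} → SquareFree m → Prime p → p ℕ.∣ m → + p ∥ + m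
  squarefree⇒∥ {m} {p} sqf p-prime (ℕ.divides c m≡c*p) = + c , trans (cong +_ m≡c*p) (ℤ.pos-* c p) , p∤c
    where
    p∤c : ¬ + p ∣ + c
    p∤c p∣c = sqf p p-prime (subst (ℕ._∣_ (p ℕ.* p)) (sym m≡c*p) (ℕ.*-monoˡ-∣ p (∣⇒∣ᵤ p∣c)))

  p∣N⇒p∤1+N² : ∀ {p N} → Prime p → + p ∣ N → ¬ + p ∣ 1ℤ + N * N
  p∣N⇒p∤1+N² {p} {N} p-prime p∣N p∣1+N² = ¬prime[1] (subst Prime (ℕ.∣1⇒≡1 (∣⇒∣ᵤ p∣1)) p-prime)
    where
    p∣1 : + p ∣ 1ℤ
    p∣1 = ∣m+n∣n⇒∣m p∣1+N² (∣m⇒∣m*n N p∣N)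

open import Data.Nat using (ℕ; _+_; _*_; _%_; _<_)
open import Data.Nat.Divisibility using (_∣_)
open import Data.Nat.Primality using (Prime)
open import Data.Product using (_×_)
open import Data.Sum using (_⊎_)
open import Relation.Nullary using (¬_)
open import Relation.Binary.PropositionalEquality using (_≡_; _≢_)
open import Data.Nat.Base using (zero; suc; s≤s; z≤n; >-nonZero)
import Data.Nat.Properties as ℕ
import Data.Nat.Divisibility as ℕ
open import Data.Nat.DivMod using (m%n<n; m∣n⇒o%n%m≡o%m)
open import Data.Nat.Primality using (prime⇒nonZero; prime⇒irreducible; prime[2])
open import Data.Nat.Primality.Factorisation using (factorise)
open import Data.Integer using (+_; 1ℤ)
import Data.Integer.Divisibility.Signed as ℤ
open import Data.List using ([]; _∷_)
open import Data.Nat.ListAction using (product)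
open import Data.List.Relation.Unary.All using (_∷_)
open import Data.Product using (∃-syntax; _,_)
open import Data.Sum using (inj₁; inj₂)
open import Function using (_∘_)
open import Relation.Nullary using (yes; no; contradiction)
open import Relation.Binary.PropositionalEquality using (refl; sym; trans; subst)
open LocalObstructions

prime-factor : ∀ m → 0 < m → m ≢ 1 → ∃[ p ] Prime p × p ∣ m
prime-factor m 0<m m≢1 with factorise m {{>-nonZero 0<m}}
... | record { factors = [] ; isFactorisation = m≡1 } = contradiction m≡1 m≢1
... | record { factors = p ∷ ps ; isFactorisation = m≡p*ps ; factorsPrime = p-prime ∷ _ } =
  p , p-prime , ℕ.divides (product ps) (trans m≡p*ps (ℕ.*-comm p (product ps)))

n<n*n+1 : ∀ n → n < n * n + 1
n<n*n+1 zero    = s≤s z≤n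
n<n*n+1 (suc n) = subst (suc n <_) (ℕ.+-comm 1 _) (s≤s (ℕ.m≤m*n (suc n) (suc n)))

odd-prime : ∀ {p} → Prime p → p ≢ 2 → ¬ 2 ∣ p
odd-prime p-prime p≢2 2∣p with prime⇒irreducible p-prime 2∣p
... | inj₁ ()
... | inj₂ 2≡p = p≢2 (sym 2≡p)

≢3mod4⇒≡1,5mod8 : ∀ p → ¬ 2 ∣ p → p % 4 ≢ 3 → p % 8 ≡ 1 ⊎ p % 8 ≡ 5
≢3mod4⇒≡1,5mod8 p 2∤p p%4≢3 = residues (p % 8) (m%n<n p 8) r%2≢0 r%4≢3
  where
  r%2≢0 : p % 8 % 2 ≢ 0
  r%2≢0 r%2≡0 = 2∤p (ℕ.m%n≡0⇒n∣m p 2 (trans (sym (m∣n⇒o%n%m≡o%m 2 8 p (ℕ.divides 4 refl))) r%2≡0))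
  r%4≢3 : p % 8 % 4 ≢ 3
  r%4≢3 r%4≡3 = p%4≢3 (trans (sym (m∣n⇒o%n%m≡o%m 4 8 p (ℕ.divides 2 refl))) r%4≡3)
  residues : ∀ r → r < 8 → r % 2 ≢ 0 → r % 4 ≢ 3 → r ≡ 1 ⊎ r ≡ 5
  residues 0 _ odd _ = contradiction refl odd
  residues 1 _ _ _ = inj₁ refl
  residues 2 _ odd _ = contradiction refl odd
  residues 3 _ _ ≢3 = contradiction refl ≢3
  residues 4 _ odd _ = contradiction refl odd
  residues 5 _ _ _ = inj₂ refl
  residues 6 _ odd _ = contradiction refl odd
  residues 7 _ _ ≢3 = contradiction refl ≢3
  residues (suc (suc (suc (suc (suc (suc (suc (suc _))))))))
           (s≤s (s≤s (s≤s (s≤s (s≤s (s≤s (s≤s (s≤s ())))))))) _ _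

module _ {p} (p-prime : Prime p) where

  private
    instance _ = prime⇒nonZero p-prime
    p-euclid = ∣*⇒∣⊎∣ p-prime

  no-ℚₚ-point-p∣b₂ : ∀ {b₁ b₂ n} → SquareFree b₁ → SquareFree b₂ → p ∣ b₂ → p ∣ n → ¬ HasQₗPoint p b₁ b₂ n
  no-ℚₚ-point-p∣b₂ {b₁} {b₂} {n} sqf-b₁ sqf-b₂ p∣b₂ p∣n with p ℕ.∣? b₁
  ... | yes p∣b₁ = no-ℚₗ-point {b₁ = b₁} {b₂} {n}
    (solutions-p∥B₁-p∥B₂-p∣N p-euclid {+ b₁} {+ b₂} {+ n}
      (squarefree⇒∥ sqf-b₁ p-prime p∣b₁) (squarefree⇒∥ sqf-b₂ p-prime p∣b₂) (∣⇒+∣+ p∣n))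
  ... | no  p∤b₁ = no-ℚₗ-point {b₁ = b₁} {b₂} {n} (AllSolutionsDivisible-p²⇒p³ {+ p} {+ b₁} {+ b₂} {+ n}
    (solutions-p∥B₂ p-euclid {+ b₁} {+ b₂} {+ n}
      (p∤b₁ ∘ +∣+⇒∣) (squarefree⇒∥ sqf-b₂ p-prime p∣b₂) (p∣N⇒p∤1+N² p-prime (∣⇒+∣+ p∣n))))

  no-ℚₚ-point-p∣b₁-p∤n : ∀ {b₁ n} → SquareFree b₁ → p ∣ b₁ → ¬ p ∣ n → ¬ HasQₗPoint p b₁ 1 n
  no-ℚₚ-point-p∣b₁-p∤n {b₁} {n} sqf-b₁ p∣b₁ p∤n =
    no-ℚₗ-point {b₁ = b₁} {1} {n} (AllSolutionsDivisible-p²⇒p³ {+ p} {+ b₁} {1ℤ} {+ n}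
      (solutions-p∥B₁-p∤N p-euclid {+ b₁} {1ℤ} {+ n}
        (squarefree⇒∥ sqf-b₁ p-prime p∣b₁) (p∤1 p-prime) (p∤n ∘ +∣+⇒∣)))

  no-ℚₚ-point-p≡3mod4 : ∀ {b₁ n} → SquareFree b₁ → p ∣ b₁ → p % 4 ≡ 3 → ¬ HasQₗPoint p b₁ 1 n
  no-ℚₚ-point-p≡3mod4 {b₁} {n} sqf-b₁ p∣b₁ p%4≡3 =
    no-ℚₗ-point {b₁ = b₁} {1} {n} (AllSolutionsDivisible-p²⇒p³ {+ p} {+ b₁} {1ℤ} {+ n}
      (solutions-p∥B₁-B₂≡1 p-euclid {+ b₁} {+ n}
        (p∤1 p-prime) (∣x²+y²⇒∣x p-prime p%4≡3) (squarefree⇒∥ sqf-b₁ p-prime p∣b₁)))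

no-ℚ₂-point-2∣b₁ : ∀ {b₁ n} → SquareFree b₁ → SquareFree n → 2 ∣ b₁ → 2 ∣ n → ¬ HasQₗPoint 2 b₁ 1 n
no-ℚ₂-point-2∣b₁ {b₁} {n} sqf-b₁ sqf-n 2∣b₁ 2∣n = no-ℚₗ-point {b₁ = b₁} {1} {n}
  (solutions-2∥B₁-2∥N {+ b₁} {+ n} (squarefree⇒∥ sqf-b₁ prime[2] 2∣b₁) (squarefree⇒∥ sqf-n prime[2] 2∣n))

b₂≡1 : ∀ {n q b₁ b₂} → 2 ∣ n → ¬ q ∣ b₂ → SquareFree b₁ → SquareFree b₂ → 0 < b₂ → FactorsIn b₂ q n →
       InSelmerFinite b₁ b₂ n → b₂ ≡ 1
b₂≡1 {n} {q} {b₁} {b₂} 2∣n q∤b₂ sqf-b₁ sqf-b₂ 0<b₂ factors-b₂ selmer with b₂ ℕ.≟ 1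
... | yes b₂≡1 = b₂≡1
... | no  b₂≢1 with prime-factor b₂ 0<b₂ b₂≢1
...   | p , p-prime , p∣b₂ = contradiction (selmer p p-prime) (no-ℚₚ-point-p∣b₂ p-prime sqf-b₁ sqf-b₂ p∣b₂ p∣n)
  where
  p∣n : p ∣ n
  p∣n with factors-b₂ p p-prime p∣b₂
  ... | inj₁ refl        = 2∣n
  ... | inj₂ (inj₁ refl) = contradiction p∣b₂ q∤b₂
  ... | inj₂ (inj₂ p∣n)  = p∣n

prime-divisors-of-b₁ : ∀ {n q b₁} → SquareFree n → 2 ∣ n → Prime q → ¬ q ∣ n → SquareFree b₁ →
                       FactorsIn b₁ q n → InSelmerFinite b₁ 1 n →
                       ∀ p → Prime p → p ∣ b₁ → (p % 8 ≡ 1 ⊎ p % 8 ≡ 5) × p ≢ q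
prime-divisors-of-b₁ {n} {q} sqf-n 2∣n q-prime q∤n sqf-b₁ factors-b₁ selmer p p-prime p∣b₁
  with factors-b₁ p p-prime p∣b₁
... | inj₁ refl        = contradiction (selmer 2 prime[2]) (no-ℚ₂-point-2∣b₁ sqf-b₁ sqf-n p∣b₁ 2∣n)
... | inj₂ (inj₁ refl) = contradiction (selmer q q-prime) (no-ℚₚ-point-p∣b₁-p∤n q-prime sqf-b₁ p∣b₁ q∤n)
... | inj₂ (inj₂ p∣n)  = ≢3mod4⇒≡1,5mod8 p (odd-prime p-prime p≢2) p%4≢3 , p≢q
  where
  p≢2 : p ≢ 2
  p≢2 refl = no-ℚ₂-point-2∣b₁ sqf-b₁ sqf-n p∣b₁ 2∣n (selmer 2 prime[2])
  p%4≢3 : p % 4 ≢ 3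
  p%4≢3 p%4≡3 = no-ℚₚ-point-p≡3mod4 p-prime {n = n} sqf-b₁ p∣b₁ p%4≡3 (selmer p p-prime)
  p≢q : p ≢ q
  p≢q refl = q∤n p∣n

lemma2p3 : (n q b₁ b₂ : ℕ) →
    0 < n → SquareFree n → 2 ∣ n → q ≡ n * n + 1 → Prime q →
    0 < b₁ → 0 < b₂ → SquareFree b₁ → SquareFree b₂ → ¬ (q ∣ b₂) →
    FactorsIn b₁ q n → FactorsIn b₂ q n →
    InSelmerFinite b₁ b₂ n →
    b₂ ≡ 1 × (∀ p → Prime p → p ∣ b₁ → (p % 8 ≡ 1 ⊎ p % 8 ≡ 5) × p ≢ q)
lemma2p3 n q b₁ b₂ 0<n sqf-n 2∣n refl q-prime _ 0<b₂ sqf-b₁ sqf-b₂ q∤b₂ factors-b₁ factors-b₂ selmer =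
  b₂≡1′ , prime-divisors-of-b₁ sqf-n 2∣n q-prime q∤n sqf-b₁ factors-b₁ selmer₁
  where
  b₂≡1′ : b₂ ≡ 1
  b₂≡1′ = b₂≡1 2∣n q∤b₂ sqf-b₁ sqf-b₂ 0<b₂ factors-b₂ selmer
  selmer₁ : InSelmerFinite b₁ 1 n
  selmer₁ = subst (λ b → InSelmerFinite b₁ b n) b₂≡1′ selmer
  q∤n : ¬ n * n + 1 ∣ n
  q∤n q∣n = ℕ.<⇒≱ (n<n*n+1 n) (ℕ.∣⇒≤ {{>-nonZero 0<n}} q∣n)
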